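{- There exists $\alpha_0>0$ such that for every $0<\alpha'\le\alpha_0$ there exists $n_0$ with the following property. Let $H$ be a balanced tripartite graph on $3m=n\geq n_0$ vertices with $V(H)$ partitioned into $A_1,A_2,A_3$ (each of size $m$). Suppose $T=\{t_1,t_2,\dots,t_m\}$ is a collection of vertex-disjoint triangles covering $V(H)$, and that for all $i\neq j$, $\delta(A_i,A_j)\geq(1-\alpha')m$. Then $H$ contains the square of a Hamiltonian cycle. Furthermore, $H$ contains the square of a Hamiltonian path which starts with (the three vertices of) $t_1$ and ends with (the three vertices of) $t_m$.
   Context: A tripartite graph with parts $A_1,A_2,A_3$ has all edges between distinct parts; balanced means the parts have equal size. $\deg(v,B)$ is the number of neighbours of $v$ in $B$ and $\delta(A,B)=\min_{v\in A}\deg(v,B)$. The square of a path (square path) $v_1v_2\dots v_k$ in a graph is a sequence of distinct vertices such that $v_iv_j$ is an edge whenever $1\le |i-j|\le 2$; a square Hamiltonian path/cycle uses all vertices (for the cycle, indices are taken cyclically). -}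

module Defs where

open import Data.Nat using (ℕ; zero; suc; _+_; _*_; _≤_; _<_)
open import Data.Fin using (Fin; toℕ)
open import Data.Bool using (Bool; true; false; if_then_else_; T)
open import Data.List using (List; map; allFin)
open import Data.Nat.ListAction using (sum)
open import Data.Product using (_×_; _,_; ∃; ∃-syntax)
open import Data.Sum using (_⊎_)
open import Relation.Binary.PropositionalEquality using (_≡_; _≢_)

-- Vertices of a balanced tripartite graph with parts of size m:
-- vertex (i , x) is the x-th vertex of part A_i  (i : Fin 3).
Vtx : ℕ → Set
Vtx m = Fin 3 × Fin m

part : ∀ {m} → Vtx m → Fin 3
part (i , _) = i

record TriGraph (m : ℕ) : Set where
  field
    adj       : Vtx m → Vtx m → Bool
    adj-sym   : ∀ u v → adj u v ≡ adj v u
    adj-parts : ∀ u v → part u ≡ part v → adj u v ≡ false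
open TriGraph public

Adj : ∀ {m} → TriGraph m → Vtx m → Vtx m → Set
Adj H u v = T (adj H u v)

deg : ∀ {m} → TriGraph m → Vtx m → Fin 3 → ℕ
deg {m} H v j = sum (map (λ y → if adj H v (j , y) then 1 else 0) (allFin m))

-- t : Fin m → Fin 3 → Vtx m is a collection of m vertex-disjoint
-- triangles covering V(H): each t k is a triangle, and the map
-- (k , r) ↦ t k r is injective (vertex-disjoint) and surjective (covering).
IsTriangleCover : ∀ {m} → TriGraph m → (Fin m → Fin 3 → Vtx m) → Set
IsTriangleCover {m} H t =
  (∀ k r s → r ≢ s → Adj H (t k r) (t k s)) ×
  (∀ k k' r r' → t k r ≡ t k' r' → (k ≡ k') × (r ≡ r')) ×
  (∀ v → ∃[ k ] ∃[ r ] (t k r ≡ v))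

IsEnumeration : ∀ {m} (N : ℕ) → (Fin N → Vtx m) → Set
IsEnumeration {m} N f = (∀ i j → f i ≡ f j → i ≡ j) × (∀ v → ∃[ i ] (f i ≡ v))

IsSquareHamPath : ∀ {m} → TriGraph m → (N : ℕ) → (Fin N → Vtx m) → Set
IsSquareHamPath H N f =
  IsEnumeration N f ×
  (∀ i j → toℕ i < toℕ j → toℕ j ≤ 2 + toℕ i → Adj H (f i) (f j))

IsSquareHamCycle : ∀ {m} → TriGraph m → (N : ℕ) → (Fin N → Vtx m) → Set
IsSquareHamCycle H N f =
  IsEnumeration N f ×
  (∀ i j → (toℕ i + 1 ≡ toℕ j ⊎ toℕ i + 2 ≡ toℕ j ⊎
            toℕ i + 1 ≡ toℕ j + N ⊎ toℕ i + 2 ≡ toℕ j + N) →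
           Adj H (f i) (f j))

StartsWith : ∀ {m} (N : ℕ) → (Fin N → Vtx m) → (Fin 3 → Vtx m) → Set
StartsWith N f τ = ∀ r → ∃[ p ] (toℕ p < 3 × f p ≡ τ r)

EndsWith : ∀ {m} (N : ℕ) → (Fin N → Vtx m) → (Fin 3 → Vtx m) → Set
EndsWith N f τ = ∀ r → ∃[ p ] (N ≤ toℕ p + 3 × f p ≡ τ r)

module Submission where

-- Order the vertices of each triangle of T by part, as u₀u₁u₂ with uᵢ in part i. Concatenating the
-- ordered triangles in some order gives a square path as soon as every two consecutive triangles u, v
-- carry the edges u₂v₀, u₁v₀, u₂v₁; say then that u precedes v. With α₀ = 1/100 a vertex misses at
-- most m/100 vertices of each other part, so a triangle fails to precede, or to be preceded by, at
-- most B = 3⌊m/100⌋ triangles, and 4B + 2 < m once n ≥ 300. In such a digraph a Hamiltonian path from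
-- a to any b ≠ a is found greedily: grow a path of 2B + 2 vertices backwards from b whose first vertex
-- is always an out-neighbour of a, prepend a, and insert every missing vertex w between consecutive
-- vertices u, u' with u → w → u', which exist because at most 2B gaps are blocked for w. A path of
-- triangles starting with t₁ and ending with t_m gives the square Hamiltonian path; ending it with a
-- predecessor of t₁ instead closes a square Hamiltonian cycle.

module Lists where
  open import Data.Bool using (Bool; true; false; not; if_then_else_)
  open import Data.Empty using (⊥-elim)
  open import Data.Fin as Fin using (Fin; toℕ; punchOut)
  open import Data.Fin.Properties using (toℕ-injective; toℕ<n; any?; ¬∀⟶∃¬; injective⇒≤; punchOut-injective)
  open import Data.List using (List; []; _∷_; _++_; length; filter; map; lookup; head; last)
  open import Data.List.Membership.Propositional using (_∈_; _∉_)
  open import Data.List.Membership.Propositional.Properties using (∈-++⁺ʳ; ∈-filter⁺)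
  open import Data.List.Properties using (filter-notAll)
  open import Data.List.Relation.Binary.Subset.Propositional using (_⊆_)
  open import Data.List.Relation.Unary.All as All using (All; _∷_)
  open import Data.List.Relation.Unary.All.Properties using (¬Any⇒All¬)
  open import Data.List.Relation.Unary.Any as Any using (here; there)
  open import Data.List.Relation.Unary.Any.Properties using (lookup-index)
  open import Data.List.Relation.Unary.AllPairs using (_∷_)
  open import Data.List.Relation.Unary.Linked using (Linked; [-]; _∷_)
  open import Data.List.Relation.Unary.Unique.Propositional using (Unique)
  open import Data.List.Relation.Unary.Unique.Propositional.Properties using (Unique[x∷xs]⇒x∉xs)
  open import Data.Maybe using (just)
  open import Data.Nat using (ℕ; zero; suc; pred; _+_; _≤_; _<_; z≤n; s≤s)
  open import Data.Nat.ListAction using (sum)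
  open import Data.Nat.Properties using (+-suc; +-monoˡ-<; +-monoʳ-<; ≤-trans; <⇒≱; 1+n≰n)
  open import Data.Product using (∃; _×_; _,_)
  open import Function using (_∘_)
  open import Function.Definitions using (Injective)
  open import Relation.Binary.Definitions using (DecidableEquality)
  open import Relation.Binary.PropositionalEquality
  open import Relation.Nullary using (yes; no; ¬?; contradiction)
  open import Relation.Nullary.Decidable using (T?)

  module _ {A : Set} where

    nth : A → List A → ℕ → A
    nth d []       _       = d
    nth d (x ∷ xs) zero    = x
    nth d (x ∷ xs) (suc q) = nth d xs q

    nth-∈ : ∀ d xs {q} → q < length xs → nth d xs q ∈ xs
    nth-∈ d (x ∷ xs) {zero}  _        = here refl
    nth-∈ d (x ∷ xs) {suc q} (s≤s q<) = there (nth-∈ d xs q<)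

    ∈⇒nth : ∀ d {xs v} → v ∈ xs → ∃ λ q → q < length xs × nth d xs q ≡ v
    ∈⇒nth d (here refl) = 0 , s≤s z≤n , refl
    ∈⇒nth d (there v∈) with q , q< , eq ← ∈⇒nth d v∈ = suc q , s≤s q< , eq

    nth-injective : ∀ d {xs} → Unique xs → ∀ {p q} → p < length xs → q < length xs →
                    nth d xs p ≡ nth d xs q → p ≡ q
    nth-injective d {x ∷ xs} _ {zero} {zero} _ _ _ = refl
    nth-injective d {x ∷ xs} (x∉ ∷ _) {zero} {suc q} _ (s≤s q<) eq =
      ⊥-elim (All.lookup x∉ (nth-∈ d xs q<) eq)
    nth-injective d {x ∷ xs} (x∉ ∷ _) {suc p} {zero} (s≤s p<) _ eq =
      ⊥-elim (All.lookup x∉ (nth-∈ d xs p<) (sym eq))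
    nth-injective d {x ∷ xs} (_ ∷ un) {suc p} {suc q} (s≤s p<) (s≤s q<) eq =
      cong suc (nth-injective d un p< q< eq)

    nth-linked : ∀ d {R : A → A → Set} {xs} → Linked R xs →
                 ∀ {q} → suc q < length xs → R (nth d xs q) (nth d xs (suc q))
    nth-linked d [-]      {_}     (s≤s ())
    nth-linked d (r ∷ _)  {zero}  _         = r
    nth-linked d (_ ∷ lk) {suc q} (s≤s q<)  = nth-linked d lk q<

    nth-head : ∀ d {xs a} → head xs ≡ just a → nth d xs 0 ≡ a
    nth-head d {x ∷ xs} refl = refl

    nth-last : ∀ d {xs b} → last xs ≡ just b → nth d xs (pred (length xs)) ≡ b
    nth-last d {x ∷ []}     refl = refl
    nth-last d {x ∷ y ∷ xs} eq   = nth-last d {y ∷ xs} eq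

    module _ {u w u' : A} {zs : List A} where

      linked-insert : ∀ {R : A → A → Set} ys → Linked R (ys ++ u ∷ u' ∷ zs) → R u w → R w u' →
                      Linked R (ys ++ u ∷ w ∷ u' ∷ zs)
      linked-insert []           (_ ∷ lk) uw wu' = uw ∷ wu' ∷ lk
      linked-insert (y ∷ [])     (r ∷ lk) uw wu' = r ∷ linked-insert [] lk uw wu'
      linked-insert (y ∷ y' ∷ ys) (r ∷ lk) uw wu' = r ∷ linked-insert (y' ∷ ys) lk uw wu'

      all-insert : ∀ {P : A → Set} ys → All P (ys ++ u ∷ u' ∷ zs) → P w → All P (ys ++ u ∷ w ∷ u' ∷ zs)
      all-insert []       (pu ∷ ps) pw = pu ∷ pw ∷ ps
      all-insert (y ∷ ys) (py ∷ ps) pw = py ∷ all-insert ys ps pw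

      unique-insert : ∀ ys → Unique (ys ++ u ∷ u' ∷ zs) → w ∉ ys ++ u ∷ u' ∷ zs →
                      Unique (ys ++ u ∷ w ∷ u' ∷ zs)
      unique-insert [] (u∉ ∷ un) w∉ =
        ((λ u≡w → w∉ (here (sym u≡w))) ∷ u∉) ∷ ¬Any⇒All¬ _ (w∉ ∘ there) ∷ un
      unique-insert (y ∷ ys) (y∉ ∷ un) w∉ =
        all-insert ys y∉ (λ y≡w → w∉ (here (sym y≡w))) ∷ unique-insert ys un (w∉ ∘ there)

      ⊆-insert : ∀ ys → ys ++ u ∷ u' ∷ zs ⊆ ys ++ u ∷ w ∷ u' ∷ zs
      ⊆-insert []       (here eq)  = here eq
      ⊆-insert []       (there v∈) = there (there v∈)
      ⊆-insert (y ∷ ys) (here eq)  = here eq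
      ⊆-insert (y ∷ ys) (there v∈) = there (⊆-insert ys v∈)

      head-insert : ∀ ys → head (ys ++ u ∷ w ∷ u' ∷ zs) ≡ head (ys ++ u ∷ u' ∷ zs)
      head-insert []      = refl
      head-insert (_ ∷ _) = refl

      last-insert : ∀ ys → last (ys ++ u ∷ w ∷ u' ∷ zs) ≡ last (ys ++ u ∷ u' ∷ zs)
      last-insert []            = refl
      last-insert (y ∷ [])      = refl
      last-insert (y ∷ y' ∷ ys) = last-insert (y' ∷ ys)

      length-insert : ∀ ys → length (ys ++ u ∷ w ∷ u' ∷ zs) ≡ suc (length (ys ++ u ∷ u' ∷ zs))
      length-insert []       = refl
      length-insert (y ∷ ys) = cong suc (length-insert ys)

    length-filter-not+count : ∀ (p : A → Bool) xs →
      length (filter (λ x → T? (not (p x))) xs) + sum (map (λ x → if p x then 1 else 0) xs) ≡ length xs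
    length-filter-not+count p []       = refl
    length-filter-not+count p (x ∷ xs) with p x
    ... | true  = trans (+-suc _ _) (cong suc (length-filter-not+count p xs))
    ... | false = cong suc (length-filter-not+count p xs)

  module _ {A : Set} (_≟_ : DecidableEquality A) where
    open import Data.List.Membership.DecPropositional _≟_ using (_∈?_)

    _without_ : List A → A → List A
    xs without u = filter (λ x → ¬? (x ≟ u)) xs

    without-shorter : ∀ {u xs} → u ∈ xs → length (xs without u) < length xs
    without-shorter {u} {xs} u∈ = filter-notAll (λ x → ¬? (x ≟ u)) xs (Any.map (λ x≡u x≢u → x≢u (sym x≡u)) u∈)

    ∈-without : ∀ {u v xs} → v ∈ xs → v ≢ u → v ∈ xs without u
    ∈-without {u} = ∈-filter⁺ (λ x → ¬? (x ≟ u))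

    record Gap (I O xs : List A) : Set where
      constructor gap
      field
        before : List A
        left right : A
        after : List A
        splits : xs ≡ before ++ left ∷ right ∷ after
        left∉I : left ∉ I
        right∉O : right ∉ O

    private
      ∈-split : ∀ {xs : List A} {l r : A} before {after} → xs ≡ before ++ l ∷ r ∷ after → l ∈ xs
      ∈-split before refl = ∈-++⁺ʳ before (here refl)

      ∈-split-tail : ∀ {x l r : A} {xs} before {after} → x ∷ xs ≡ before ++ l ∷ r ∷ after → r ∈ xs
      ∈-split-tail []       refl = here refl
      ∈-split-tail (_ ∷ bs) refl = ∈-++⁺ʳ bs (there (here refl))

    -- If the first pair fails, recurse on the tail after deleting its first vertex from I or its second
    -- from O; by uniqueness the deleted vertex cannot occur in a later gap.
    gap-exists : ∀ I O {xs} → Unique xs → 2 + (length I + length O) ≤ length xs → Gap I O xs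
    gap-exists I O {[]}         _ ()
    gap-exists I O {_ ∷ []}     _ (s≤s ())
    gap-exists I O {u ∷ u' ∷ zs} (u∉ ∷ un) (s≤s room) with u ∈? I | u' ∈? O
    ... | no u∉I | no u'∉O = gap [] u u' zs refl u∉I u'∉O
    ... | yes u∈I | _
      with gap bs l r rest eq l∉ r∉ ← gap-exists (I without u) O un
                                      (≤-trans (s≤s (+-monoˡ-< (length O) (without-shorter u∈I))) room)
      = gap (u ∷ bs) l r rest (cong (u ∷_) eq)
            (λ l∈I → l∉ (∈-without l∈I (λ l≡u → All.lookup u∉ (∈-split bs eq) (sym l≡u)))) r∉
    ... | no u∉I | yes u'∈O
      with gap bs l r rest eq l∉ r∉ ← gap-exists I (O without u') un
                                      (≤-trans (s≤s (+-monoʳ-< (length I) (without-shorter u'∈O))) room)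
      = gap (u ∷ bs) l r rest (cong (u ∷_) eq) l∉
            (λ r∈O → r∉ (∈-without r∈O λ r≡u' →
              Unique[x∷xs]⇒x∉xs un (subst (_∈ zs) r≡u' (∈-split-tail bs eq))))

  module _ {m : ℕ} where
    open import Data.List.Membership.DecPropositional (Fin._≟_ {m}) using (_∈?_)

    unique⇒length≤ : ∀ {xs : List (Fin m)} → Unique xs → length xs ≤ m
    unique⇒length≤ {[]}     _  = z≤n
    unique⇒length≤ {x ∷ xs} un = injective⇒≤ {f = λ i → nth x (x ∷ xs) (toℕ i)}
      (λ eq → toℕ-injective (nth-injective x un (toℕ<n _) (toℕ<n _) eq))

    complete⇒length≥ : ∀ {xs : List (Fin m)} → (∀ v → v ∈ xs) → m ≤ length xs
    complete⇒length≥ {xs} all∈ = injective⇒≤ {f = λ v → Any.index (all∈ v)} index-injective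
      where
      index-injective : ∀ {v w} → Any.index (all∈ v) ≡ Any.index (all∈ w) → v ≡ w
      index-injective {v} {w} eq =
        trans (lookup-index (all∈ v)) (trans (cong (lookup xs) eq) (sym (lookup-index (all∈ w))))

    short⇒∃∉ : (xs : List (Fin m)) → length xs < m → ∃ λ v → v ∉ xs
    short⇒∃∉ xs short = ¬∀⟶∃¬ m (_∈ xs) (_∈? xs) (λ all∈ → <⇒≱ short (complete⇒length≥ all∈))

  injective⇒surjective : ∀ {n} {f : Fin n → Fin n} → Injective _≡_ _≡_ f → ∀ i → ∃ λ j → f j ≡ i
  injective⇒surjective {suc n} {f} f-injective i with any? (λ j → f j Fin.≟ i)
  ... | yes hit  = hit
  ... | no  miss = contradiction (injective⇒≤ punched-injective) 1+n≰n
    where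
    missed : ∀ j → i ≢ f j
    missed j i≡fj = miss (j , sym i≡fj)
    punched : Fin (suc n) → Fin n
    punched j = punchOut (missed j)
    punched-injective : Injective _≡_ _≡_ punched
    punched-injective {j} {j'} eq = f-injective (punchOut-injective (missed j) (missed j') eq)

module Digraphs where
  open Lists
  open import Data.Fin as Fin using (Fin)
  open import Data.List using (List; []; _∷_; _++_; length; allFin; head; last)
  open import Data.List.Membership.Propositional using (_∈_; _∉_)
  open import Data.List.Membership.Propositional.Properties using (∈-++⁺ˡ; ∈-++⁺ʳ; ∈-allFin)
  open import Data.List.Properties using (length-++)
  open import Data.List.Relation.Binary.Subset.Propositional using (_⊆_)
  open import Data.List.Relation.Unary.All.Properties using (¬Any⇒All¬)
  open import Data.List.Relation.Unary.Any using (here; there)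
  open import Data.List.Relation.Unary.AllPairs using ([]; _∷_)
  open import Data.List.Relation.Unary.All using ([])
  open import Data.List.Relation.Unary.Linked using (Linked; [-]; _∷_)
  open import Data.List.Relation.Unary.Unique.Propositional using (Unique)
  open import Data.Maybe using (just)
  open import Data.Nat using (ℕ; zero; suc; pred; _+_; _*_; _≤_; _<_; z≤n; s≤s; s≤s⁻¹)
  open import Data.Nat.Properties
    using (≤-refl; ≤-trans; ≤-reflexive; ≤-antisym; +-mono-≤; +-monoʳ-≤; +-monoˡ-≤; n≤1+n; module ≤-Reasoning)
  open import Data.Nat.Solver using (module +-*-Solver)
  open import Data.Product using (Σ; ∃; _×_; _,_)
  open import Function using (_∘_)
  open import Relation.Binary.PropositionalEquality
  open import Relation.Nullary using (yes; no)
  open +-*-Solver using (solve; _:+_; _:*_; _:=_; con)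

  -- A Hamiltonian path is recorded by its vertex at each position; positions beyond k carry junk.
  record HamiltonianPath {k} (R : Fin (suc k) → Fin (suc k) → Set) (a b : Fin (suc k)) : Set where
    field
      at            : ℕ → Fin (suc k)
      at-injective  : ∀ {p q} → p ≤ k → q ≤ k → at p ≡ at q → p ≡ q
      at-surjective : ∀ v → ∃ λ q → q ≤ k × at q ≡ v
      at-step       : ∀ {q} → q < k → R (at q) (at (suc q))
      at-first      : at 0 ≡ a
      at-last       : at k ≡ b

  module _ {k} {R : Fin (suc k) → Fin (suc k) → Set} {a b : Fin (suc k)} where

    list⇒hamiltonianPath : ∀ xs → Unique xs → Linked R xs → head xs ≡ just a → last xs ≡ just b →
                          (∀ v → v ∈ xs) → HamiltonianPath R a b
    list⇒hamiltonianPath xs unique linked starts ends complete = record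
      { at            = nth a xs
      ; at-injective  = λ p≤k q≤k → nth-injective a unique (bounded p≤k) (bounded q≤k)
      ; at-surjective = λ v → let q , q< , eq = ∈⇒nth a (complete v) in
                              q , s≤s⁻¹ (subst (q <_) length≡ q<) , eq
      ; at-step       = λ q<k → nth-linked a linked (bounded q<k)
      ; at-first      = nth-head a starts
      ; at-last       = subst (λ n → nth a xs (pred n) ≡ b) length≡ (nth-last a {xs} ends)
      }
      where
      length≡ : length xs ≡ suc k
      length≡ = ≤-antisym (unique⇒length≤ unique) (complete⇒length≥ complete)
      bounded : ∀ {q} → q ≤ k → q < length xs
      bounded {q} q≤k = subst (q <_) (sym length≡) (s≤s q≤k)

  module DenseDigraph {k} (R : Fin (suc k) → Fin (suc k) → Set) (B : ℕ)
    (nonOut nonIn : Fin (suc k) → List (Fin (suc k)))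
    (nonOut-bounded : ∀ u → length (nonOut u) ≤ B) (nonIn-bounded : ∀ v → length (nonIn v) ≤ B)
    (∉nonOut⇒R : ∀ {u v} → v ∉ nonOut u → R u v) (∉nonIn⇒R : ∀ {u v} → u ∉ nonIn v → R u v)
    (B-small : 4 * B + 2 < suc k) {a b : Fin (suc k)} (a≢b : a ≢ b) where

    private
      m = suc k
    open import Data.List.Membership.DecPropositional (Fin._≟_ {m}) using (_∈?_)

    record LeadIn (n : ℕ) : Set where
      constructor leadIn
      field
        first    : Fin m
        rest     : List (Fin m)
        unique   : Unique (first ∷ rest)
        linked   : Linked R (first ∷ rest)
        a∉       : a ∉ first ∷ rest
        length≡  : length rest ≡ suc n
        ends     : last (first ∷ rest) ≡ just b
        a→first  : R a first

    private
      excluded : Fin m → List (Fin m) → List (Fin m)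
      excluded v vs = a ∷ nonIn v ++ nonOut a ++ v ∷ vs

      excluded-length : ∀ v vs → length (excluded v vs) ≤ suc (B + (B + length (v ∷ vs)))
      excluded-length v vs = s≤s (begin
        length (nonIn v ++ nonOut a ++ v ∷ vs)                   ≡⟨ length-++ (nonIn v) ⟩
        length (nonIn v) + length (nonOut a ++ v ∷ vs)           ≡⟨ cong (length (nonIn v) +_) (length-++ (nonOut a)) ⟩
        length (nonIn v) + (length (nonOut a) + length (v ∷ vs)) ≤⟨ +-mono-≤ (nonIn-bounded v) (+-monoˡ-≤ _ (nonOut-bounded a)) ⟩
        B + (B + length (v ∷ vs))                                ∎)
        where open ≤-Reasoning

    extension : ∀ v vs → 2 + (B + (B + length (v ∷ vs))) ≤ m →
                ∃ λ w → w ∉ v ∷ vs × w ≢ a × R w v × R a w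
    extension v vs room with w , w∉ ← short⇒∃∉ (excluded v vs) (≤-trans (s≤s (excluded-length v vs)) room)
      = w , w∉ ∘ there ∘ ∈-++⁺ʳ (nonIn v) ∘ ∈-++⁺ʳ (nonOut a) , w∉ ∘ here
          , ∉nonIn⇒R (w∉ ∘ there ∘ ∈-++⁺ˡ) , ∉nonOut⇒R (w∉ ∘ there ∘ ∈-++⁺ʳ (nonIn v) ∘ ∈-++⁺ˡ)

    private
      room : ∀ l → l ≤ suc (B + B) → 2 + (B + (B + l)) ≤ m
      room l l≤ = begin
        2 + (B + (B + l))            ≡⟨ solve 2 (λ B l → con 2 :+ (B :+ (B :+ l)) := con 2 :+ (B :+ B) :+ l) refl B l ⟩
        2 + (B + B) + l              ≤⟨ +-monoʳ-≤ (2 + (B + B)) l≤ ⟩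
        2 + (B + B) + suc (B + B)    ≡⟨ solve 1 (λ B → con 2 :+ (B :+ B) :+ (con 1 :+ (B :+ B)) := con 1 :+ (con 4 :* B :+ con 2)) refl B ⟩
        suc (4 * B + 2)              ≤⟨ B-small ⟩
        m                            ∎
        where open ≤-Reasoning

    leadIn-exists : ∀ n → n ≤ B + B → LeadIn n
    leadIn-exists zero _ with w , w∉ , w≢a , wb , aw ← extension b [] (room 1 (s≤s z≤n))
      = leadIn w (b ∷ []) (¬Any⇒All¬ _ w∉ ∷ [] ∷ []) (wb ∷ [-])
               (λ { (here a≡w) → w≢a (sym a≡w) ; (there (here a≡b)) → a≢b a≡b }) refl refl aw
    leadIn-exists (suc n) n< with leadIn v vs un lk a∉ len en av ← leadIn-exists n (≤-trans (n≤1+n n) n<)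
                             with w , w∉ , w≢a , wv , aw ←
                                    extension v vs (subst (λ l → 2 + (B + (B + suc l)) ≤ m) (sym len) (room _ (s≤s n<)))
      = leadIn w (v ∷ vs) (¬Any⇒All¬ _ w∉ ∷ un) (wv ∷ lk)
               (λ { (here a≡w) → w≢a (sym a≡w) ; (there a∈) → a∉ a∈ }) (cong suc len) en aw

    record Path : Set where
      constructor path
      field
        vertices : List (Fin m)
        unique   : Unique vertices
        linked   : Linked R vertices
        starts   : head vertices ≡ just a
        ends     : last vertices ≡ just b
        long     : 2 + (B + B) ≤ length vertices
    open Path

    initialPath : Path
    initialPath with leadIn v vs un lk a∉ len en av ← leadIn-exists (B + B) ≤-refl
      = path (a ∷ v ∷ vs) (¬Any⇒All¬ _ a∉ ∷ un) (av ∷ lk) refl en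
             (s≤s (s≤s (≤-trans (n≤1+n _) (≤-reflexive (sym len)))))

    insert : ∀ P w → Σ Path λ P' → vertices P ⊆ vertices P' × w ∈ vertices P'
    insert P w with w ∈? vertices P
    ... | yes w∈ = P , (λ v∈ → v∈) , w∈
    insert (path vs un lk st en lg) w | no w∉
      with gap ys u u' zs refl u∉ u'∉ ← gap-exists (Fin._≟_ {m}) (nonIn w) (nonOut w) un
             (≤-trans (s≤s (s≤s (+-mono-≤ (nonIn-bounded w) (nonOut-bounded w)))) lg)
      = path (ys ++ u ∷ w ∷ u' ∷ zs) (unique-insert ys un w∉) (linked-insert ys lk (∉nonIn⇒R u∉) (∉nonOut⇒R u'∉))
             (trans (head-insert ys) st) (trans (last-insert ys) en)
             (≤-trans lg (≤-trans (n≤1+n _) (≤-reflexive (sym (length-insert ys)))))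
        , ⊆-insert ys , ∈-++⁺ʳ ys (there (here refl))

    insertAll : ∀ ws P → Σ Path λ P' → vertices P ⊆ vertices P' × ws ⊆ vertices P'
    insertAll []       P = P , (λ v∈ → v∈) , λ ()
    insertAll (w ∷ ws) P with P₁ , P⊆P₁ , w∈P₁ ← insert P w
                         with P₂ , P₁⊆P₂ , ws⊆P₂ ← insertAll ws P₁ =
      P₂ , P₁⊆P₂ ∘ P⊆P₁ , λ { (here refl) → P₁⊆P₂ w∈P₁ ; (there w'∈) → ws⊆P₂ w'∈ }

    hamiltonianPath : HamiltonianPath R a b
    hamiltonianPath with P , _ , all⊆P ← insertAll (allFin m) initialPath =
      list⇒hamiltonianPath (vertices P) (unique P) (linked P) (starts P) (ends P) (all⊆P ∘ ∈-allFin)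

module SquarePaths where
  open import Defs
  open Lists
  open Digraphs
  open import Data.Bool using (true; false; T; not)
  open import Data.Empty using (⊥-elim)
  open import Data.Fin as Fin using (Fin; toℕ; fromℕ; fromℕ<)
  open import Data.Fin.Properties using (toℕ-injective; toℕ<n; toℕ-fromℕ<)
  open import Data.List using (List; _∷_; _++_; length; filter; map; allFin)
  open import Data.List.Membership.Propositional using (_∈_; _∉_)
  open import Data.List.Membership.Propositional.Properties using (∈-++⁺ˡ; ∈-++⁺ʳ; ∈-allFin; ∈-filter⁺; ∈-map⁺)
  open import Data.List.Properties using (length-++; length-map; length-tabulate)
  open import Data.List.Relation.Unary.Any using (here; there)
  open import Data.Nat using (ℕ; zero; suc; _+_; _*_; _≤_; _<_; _/_; z≤n; s≤s; s≤s⁻¹)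
  open import Data.Nat.DivMod using (m*n/n≡m; m/n*n≤m; /-monoˡ-≤)
  open import Data.Nat.Properties
    using (_≟_; suc-injective; +-comm; +-identityʳ; *-suc; ≤-refl; ≤-reflexive; ≤-trans; ≤-antisym; ≤-<-trans; ≤∧≢⇒<; <⇒≱;
           n≤1+n; m≤m+n; m≤n+m; +-mono-≤; +-monoˡ-≤; +-monoʳ-≤; +-monoˡ-<; +-cancelʳ-≤; *-monoʳ-≤; *-cancelˡ-≤; *-cancelˡ-<;
           module ≤-Reasoning)
  open import Data.Nat.Solver using (module +-*-Solver)
  open import Data.Product using (∃; ∃-syntax; _×_; _,_; proj₁; proj₂)
  open import Data.Sum using (_⊎_; inj₁; inj₂)
  open import Data.Unit using (tt)
  open import Function using (_∘_)
  open import Function.Definitions using (Injective)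
  open import Relation.Binary.PropositionalEquality
  open import Relation.Nullary using (yes; no)
  open import Relation.Nullary.Decidable using (T?)
  open +-*-Solver using (solve; _:+_; _:*_; _:=_; con)

  pattern 𝟎 = Fin.zero
  pattern 𝟏 = Fin.suc Fin.zero
  pattern 𝟐 = Fin.suc (Fin.suc Fin.zero)

  sucDivMod3 : ℕ × Fin 3 → ℕ × Fin 3
  sucDivMod3 (q , 𝟎) = q , 𝟏
  sucDivMod3 (q , 𝟏) = q , 𝟐
  sucDivMod3 (q , 𝟐) = suc q , 𝟎

  divMod3 : ℕ → ℕ × Fin 3
  divMod3 zero    = 0 , 𝟎
  divMod3 (suc n) = sucDivMod3 (divMod3 n)

  divMod3-correct : ∀ n → toℕ (proj₂ (divMod3 n)) + 3 * proj₁ (divMod3 n) ≡ n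
  divMod3-correct zero = refl
  divMod3-correct (suc n) with divMod3 n | divMod3-correct n
  ... | q , 𝟎 | eq = cong suc eq
  ... | q , 𝟏 | eq = cong suc eq
  ... | q , 𝟐 | eq = trans (*-suc 3 q) (cong suc eq)

  divMod3-unique : ∀ q r → divMod3 (toℕ r + 3 * q) ≡ (q , r)
  divMod3-unique zero    𝟎 = refl
  divMod3-unique zero    𝟏 = refl
  divMod3-unique zero    𝟐 = refl
  divMod3-unique (suc q) r = begin
    divMod3 (toℕ r + 3 * suc q)             ≡⟨ cong divMod3 (solve 2 (λ r q → r :+ con 3 :* (con 1 :+ q) := con 3 :+ (r :+ con 3 :* q)) refl (toℕ r) q) ⟩
    sucDivMod3 (sucDivMod3 (sucDivMod3 (divMod3 (toℕ r + 3 * q)))) ≡⟨ cong (sucDivMod3 ∘ sucDivMod3 ∘ sucDivMod3) (divMod3-unique q r) ⟩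
    sucDivMod3 (sucDivMod3 (sucDivMod3 (q , r)))              ≡⟨ sucDivMod3³ r ⟩
    (suc q , r)                             ∎
    where
    open ≡-Reasoning
    sucDivMod3³ : ∀ r → sucDivMod3 (sucDivMod3 (sucDivMod3 (q , r))) ≡ (suc q , r)
    sucDivMod3³ 𝟎 = refl
    sucDivMod3³ 𝟏 = refl
    sucDivMod3³ 𝟐 = refl

  one-or-two-ahead : ∀ {n n'} → n < n' → n' ≤ 2 + n → n' ≡ 1 + n ⊎ n' ≡ 2 + n
  one-or-two-ahead {n} {n'} n<n' n'≤ with n' ≟ suc n
  ... | yes eq = inj₁ eq
  ... | no  ne = inj₂ (≤-antisym n'≤ (≤∧≢⇒< n<n' (ne ∘ sym)))

  wraps₁ : ∀ {N i j} → i < N → i + 1 ≡ j + N → j ≡ 0 × 1 + i ≡ N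
  wraps₁ {N} {i} {zero}  _   eq = refl , trans (+-comm 1 i) eq
  wraps₁ {N} {i} {suc j} i<N eq = ⊥-elim (<⇒≱ i<N (subst (N ≤_) (sym i≡) (m≤n+m N j)))
    where i≡ = suc-injective (trans (+-comm 1 i) eq)

  wraps₂ : ∀ {N i j} → i < N → i + 2 ≡ j + N → (j ≡ 0 × 2 + i ≡ N) ⊎ (j ≡ 1 × 1 + i ≡ N)
  wraps₂ {N} {i} {zero}        _   eq = inj₁ (refl , trans (+-comm 2 i) eq)
  wraps₂ {N} {i} {suc zero}    _   eq = inj₂ (refl , suc-injective (trans (+-comm 2 i) eq))
  wraps₂ {N} {i} {suc (suc j)} i<N eq = ⊥-elim (<⇒≱ i<N (subst (N ≤_) (sym i≡) (m≤n+m N j)))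
    where i≡ = suc-injective (suc-injective (trans (+-comm 2 i) eq))

  module _ {k : ℕ} (H : TriGraph (suc k)) where

    private
      m = suc k

    Adj-sym : ∀ {u v} → Adj H u v → Adj H v u
    Adj-sym {u} {v} = subst T (adj-sym H u v)

    Adj⇒part≢ : ∀ {u v} → Adj H u v → part u ≢ part v
    Adj⇒part≢ {u} {v} uv eq = subst T (adj-parts H u v eq) uv

    nonNeighbours : Vtx m → Fin 3 → List (Fin m)
    nonNeighbours v j = filter (λ y → T? (not (adj H v (j , y)))) (allFin m)

    ∉nonNeighbours⇒Adj : ∀ {v j y} → y ∉ nonNeighbours v j → Adj H v (j , y)
    ∉nonNeighbours⇒Adj {v} {j} {y} y∉ with adj H v (j , y) in eq
    ... | true  = tt
    ... | false = ⊥-elim (y∉ (∈-filter⁺ (λ y → T? (not (adj H v (j , y)))) (∈-allFin y)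
                                        (subst (T ∘ not) (sym eq) tt)))

    nonNeighbours-few : ∀ {v j} → 99 * m ≤ 100 * deg H v j → length (nonNeighbours v j) ≤ m / 100
    nonNeighbours-few {v} {j} high-degree = begin
      ℓ               ≡⟨ sym (m*n/n≡m ℓ 100) ⟩
      ℓ * 100 / 100   ≤⟨ /-monoˡ-≤ 100 (+-cancelʳ-≤ (99 * m) (ℓ * 100) m ℓ*100+99m≤m+99m) ⟩
      m / 100         ∎
      where
      open ≤-Reasoning
      ℓ = length (nonNeighbours v j)
      d = deg H v j
      ℓ+d≡m : ℓ + d ≡ m
      ℓ+d≡m = trans (length-filter-not+count (λ y → adj H v (j , y)) (allFin m)) (length-tabulate (λ y → y))
      ℓ*100+99m≤m+99m : ℓ * 100 + 99 * m ≤ m + 99 * m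
      ℓ*100+99m≤m+99m = begin
        ℓ * 100 + 99 * m  ≤⟨ +-monoʳ-≤ (ℓ * 100) high-degree ⟩
        ℓ * 100 + 100 * d ≡⟨ solve 2 (λ ℓ d → ℓ :* con 100 :+ con 100 :* d := con 100 :* (ℓ :+ d)) refl ℓ d ⟩
        100 * (ℓ + d)     ≡⟨ cong (100 *_) ℓ+d≡m ⟩
        100 * m           ≡⟨ solve 1 (λ m → con 100 :* m := m :+ con 99 :* m) refl m ⟩
        m + 99 * m        ∎

    record IsSquareSequence (N : ℕ) (g : ℕ → Vtx m) : Set where
      field
        injective  : ∀ {p q} → p < N → q < N → g p ≡ g q → p ≡ q
        surjective : ∀ v → ∃ λ n → n < N × g n ≡ v
        step₁      : ∀ {n} → 1 + n < N → Adj H (g n) (g (1 + n))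
        step₂      : ∀ {n} → 2 + n < N → Adj H (g n) (g (2 + n))

    module _ {N g} (S : IsSquareSequence N g) where
      open IsSquareSequence S

      enumeration : IsEnumeration N (g ∘ toℕ)
      enumeration = (λ i j eq → toℕ-injective (injective (toℕ<n i) (toℕ<n j) eq))
                  , λ v → let n , n< , eq = surjective v in fromℕ< n< , trans (cong g (toℕ-fromℕ< n<)) eq

      private
        ahead : ∀ {n n'} → n' < N → n' ≡ 1 + n ⊎ n' ≡ 2 + n → Adj H (g n) (g n')
        ahead n'< (inj₁ refl) = step₁ n'<
        ahead n'< (inj₂ refl) = step₂ n'<

      squareHamPath : IsSquareHamPath H N (g ∘ toℕ)
      squareHamPath = enumeration , λ i j i<j j≤ → ahead (toℕ<n j) (one-or-two-ahead i<j j≤)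

      squareHamCycle : (∀ {n} → 1 + n ≡ N → Adj H (g n) (g 0) × Adj H (g n) (g 1)) →
                       (∀ {n} → 2 + n ≡ N → Adj H (g n) (g 0)) → IsSquareHamCycle H N (g ∘ toℕ)
      squareHamCycle last-closes penultimate-closes = enumeration , adjacent
        where
        adjacent : ∀ i j → toℕ i + 1 ≡ toℕ j ⊎ toℕ i + 2 ≡ toℕ j ⊎ toℕ i + 1 ≡ toℕ j + N ⊎ toℕ i + 2 ≡ toℕ j + N →
                   Adj H (g (toℕ i)) (g (toℕ j))
        adjacent i j (inj₁ eq)        = ahead (toℕ<n j) (inj₁ (trans (sym eq) (+-comm (toℕ i) 1)))
        adjacent i j (inj₂ (inj₁ eq)) = ahead (toℕ<n j) (inj₂ (trans (sym eq) (+-comm (toℕ i) 2)))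
        adjacent i j (inj₂ (inj₂ (inj₁ eq))) with j≡0 , closing ← wraps₁ (toℕ<n i) eq =
          subst (Adj H (g (toℕ i)) ∘ g) (sym j≡0) (proj₁ (last-closes closing))
        adjacent i j (inj₂ (inj₂ (inj₂ eq))) with wraps₂ (toℕ<n i) eq
        ... | inj₁ (j≡0 , closing) = subst (Adj H (g (toℕ i)) ∘ g) (sym j≡0) (penultimate-closes closing)
        ... | inj₂ (j≡1 , closing) = subst (Adj H (g (toℕ i)) ∘ g) (sym j≡1) (proj₂ (last-closes closing))

  module TriangleCover {k : ℕ} {H : TriGraph (suc k)} {t : Fin (suc k) → Fin 3 → Vtx (suc k)}
    (cover : IsTriangleCover H t) where

    private
      m = suc k
      triangle = proj₁ cover
      disjoint = proj₁ (proj₂ cover)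
      covering = proj₂ (proj₂ cover)

    part∘t-injective : ∀ τ → Injective _≡_ _≡_ (part ∘ t τ)
    part∘t-injective τ {r} {s} eq with r Fin.≟ s
    ... | yes r≡s = r≡s
    ... | no  r≢s = ⊥-elim (Adj⇒part≢ H (triangle τ r s r≢s) eq)

    private
      cornerIndex : Fin m → Fin 3 → Fin 3
      cornerIndex τ i = proj₁ (injective⇒surjective (part∘t-injective τ) i)

      part-cornerIndex : ∀ τ i → part (t τ (cornerIndex τ i)) ≡ i
      part-cornerIndex τ i = proj₂ (injective⇒surjective (part∘t-injective τ) i)

    -- The vertex of triangle τ in part i, written so that its part is i by definition.
    corner : Fin m → Fin 3 → Vtx m
    corner τ i = i , proj₂ (t τ (cornerIndex τ i))

    t≡corner : ∀ τ i → t τ (cornerIndex τ i) ≡ corner τ i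
    t≡corner τ i = cong (_, proj₂ (t τ (cornerIndex τ i))) (part-cornerIndex τ i)

    corner-part : ∀ τ r → corner τ (part (t τ r)) ≡ t τ r
    corner-part τ r = trans (sym (t≡corner τ _)) (cong (t τ) (part∘t-injective τ (part-cornerIndex τ _)))

    corner-adjacent : ∀ τ {i j} → i ≢ j → Adj H (corner τ i) (corner τ j)
    corner-adjacent τ {i} {j} i≢j = subst₂ (Adj H) (t≡corner τ i) (t≡corner τ j) (triangle τ _ _ index≢)
      where
      index≢ : cornerIndex τ i ≢ cornerIndex τ j
      index≢ eq = i≢j (trans (sym (part-cornerIndex τ i)) (trans (cong (part ∘ t τ) eq) (part-cornerIndex τ j)))

    corner-injective : ∀ {τ τ' i i'} → corner τ i ≡ corner τ' i' → τ ≡ τ' × i ≡ i'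
    corner-injective {τ} {τ'} {i} {i'} eq =
      proj₁ (disjoint τ τ' _ _ (trans (t≡corner τ i) (trans eq (sym (t≡corner τ' i'))))) , cong proj₁ eq

    triangleOf : Vtx m → Fin m
    triangleOf v = proj₁ (covering v)

    corner-triangleOf : ∀ v → corner (triangleOf v) (part v) ≡ v
    corner-triangleOf v with covering v
    ... | τ , r , refl = corner-part τ r

    triangleOf-corner : ∀ τ i → triangleOf (corner τ i) ≡ τ
    triangleOf-corner τ i = proj₁ (corner-injective (corner-triangleOf (corner τ i)))

    -- The edges a square path needs between consecutive triangles u₀u₁u₂ and v₀v₁v₂.
    record Precedes (u v : Fin m) : Set where
      field
        edge₂₀ : Adj H (corner u 𝟐) (corner v 𝟎)
        edge₁₀ : Adj H (corner u 𝟏) (corner v 𝟎)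
        edge₂₁ : Adj H (corner u 𝟐) (corner v 𝟏)

    nonNeighbourTriangles : Vtx m → Fin 3 → List (Fin m)
    nonNeighbourTriangles v j = map (λ y → triangleOf (j , y)) (nonNeighbours H v j)

    ∉nonNeighbourTriangles⇒Adj : ∀ {v j τ} → τ ∉ nonNeighbourTriangles v j → Adj H v (corner τ j)
    ∉nonNeighbourTriangles⇒Adj {v} {j} {τ} τ∉ = ∉nonNeighbours⇒Adj H λ y∈ →
      τ∉ (subst (_∈ nonNeighbourTriangles v j) (triangleOf-corner τ j) (∈-map⁺ (λ y → triangleOf (j , y)) y∈))

    nonSuccessors nonPredecessors : Fin m → List (Fin m)
    nonSuccessors u = nonNeighbourTriangles (corner u 𝟐) 𝟎 ++ nonNeighbourTriangles (corner u 𝟏) 𝟎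
                      ++ nonNeighbourTriangles (corner u 𝟐) 𝟏
    nonPredecessors v = nonNeighbourTriangles (corner v 𝟎) 𝟐 ++ nonNeighbourTriangles (corner v 𝟎) 𝟏
                        ++ nonNeighbourTriangles (corner v 𝟏) 𝟐

    ∉nonSuccessors⇒Precedes : ∀ {u v} → v ∉ nonSuccessors u → Precedes u v
    ∉nonSuccessors⇒Precedes {u} v∉ = record
      { edge₂₀ = ∉nonNeighbourTriangles⇒Adj (v∉ ∘ ∈-++⁺ˡ)
      ; edge₁₀ = ∉nonNeighbourTriangles⇒Adj (v∉ ∘ ∈-++⁺ʳ (nonNeighbourTriangles (corner u 𝟐) 𝟎) ∘ ∈-++⁺ˡ)
      ; edge₂₁ = ∉nonNeighbourTriangles⇒Adj (v∉ ∘ ∈-++⁺ʳ (nonNeighbourTriangles (corner u 𝟐) 𝟎)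
                                                ∘ ∈-++⁺ʳ (nonNeighbourTriangles (corner u 𝟏) 𝟎))
      }

    ∉nonPredecessors⇒Precedes : ∀ {u v} → u ∉ nonPredecessors v → Precedes u v
    ∉nonPredecessors⇒Precedes {v = v} u∉ = record
      { edge₂₀ = Adj-sym H (∉nonNeighbourTriangles⇒Adj (u∉ ∘ ∈-++⁺ˡ))
      ; edge₁₀ = Adj-sym H (∉nonNeighbourTriangles⇒Adj (u∉ ∘ ∈-++⁺ʳ (nonNeighbourTriangles (corner v 𝟎) 𝟐) ∘ ∈-++⁺ˡ))
      ; edge₂₁ = Adj-sym H (∉nonNeighbourTriangles⇒Adj (u∉ ∘ ∈-++⁺ʳ (nonNeighbourTriangles (corner v 𝟎) 𝟐)
                                                           ∘ ∈-++⁺ʳ (nonNeighbourTriangles (corner v 𝟎) 𝟏)))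
      }

    module _ {a b : Fin m} (P : HamiltonianPath Precedes a b) where
      open HamiltonianPath P

      vertexAt : ℕ → Vtx m
      vertexAt n = corner (at (proj₁ (divMod3 n))) (proj₂ (divMod3 n))

      vertexAt-corner : ∀ q r → vertexAt (toℕ r + 3 * q) ≡ corner (at q) r
      vertexAt-corner q r = cong (λ (q , r) → corner (at q) r) (divMod3-unique q r)

      private
        position-bounded : ∀ (r : Fin 3) {q} → q ≤ k → toℕ r + 3 * q < 3 * m
        position-bounded r {q} q≤k =
          ≤-trans (+-monoˡ-< (3 * q) (toℕ<n r)) (subst (_≤ 3 * m) (*-suc 3 q) (*-monoʳ-≤ 3 (s≤s q≤k)))

        quotient-bounded : ∀ {q n} (r : Fin 3) → toℕ r + 3 * q ≡ n → n < 3 * m → q ≤ k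
        quotient-bounded {q} r eq n< =
          s≤s⁻¹ (*-cancelˡ-< 3 q m (≤-<-trans (m≤n+m (3 * q) (toℕ r)) (subst (_< 3 * m) (sym eq) n<)))

        successor-exists : ∀ {q n} → 3 + 3 * q ≤ n → n < 3 * m → q < k
        successor-exists {q} le n< =
          s≤s⁻¹ (*-cancelˡ-< 3 (suc q) m (subst (_< 3 * m) (sym (*-suc 3 q)) (≤-<-trans le n<)))

      squareSequence : IsSquareSequence H (3 * m) vertexAt
      squareSequence = record
        { injective  = injective
        ; surjective = surjective
        ; step₁      = step₁
        ; step₂      = step₂
        }
        where
        injective : ∀ {p q} → p < 3 * m → q < 3 * m → vertexAt p ≡ vertexAt q → p ≡ q
        injective {p} {q} p< q< eq with corner-injective eq
        ... | at≡ , r≡ = begin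
          p                                                 ≡⟨ sym (divMod3-correct p) ⟩
          toℕ (proj₂ (divMod3 p)) + 3 * proj₁ (divMod3 p)   ≡⟨ cong₂ (λ r q → toℕ r + 3 * q) r≡ quotient≡ ⟩
          toℕ (proj₂ (divMod3 q)) + 3 * proj₁ (divMod3 q)   ≡⟨ divMod3-correct q ⟩
          q                                                 ∎
          where
          open ≡-Reasoning
          quotient≡ = at-injective (quotient-bounded (proj₂ (divMod3 p)) (divMod3-correct p) p<)
                                   (quotient-bounded (proj₂ (divMod3 q)) (divMod3-correct q) q<) at≡

        surjective : ∀ v → ∃ λ n → n < 3 * m × vertexAt n ≡ v
        surjective v with q , q≤k , at-q ← at-surjective (triangleOf v) =
          toℕ (part v) + 3 * q , position-bounded (part v) q≤k ,
          trans (vertexAt-corner q (part v)) (trans (cong (λ τ → corner τ (part v)) at-q) (corner-triangleOf v))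

        -- divMod3 (1 + n) reduces to sucDivMod3 (divMod3 n), so splitting on divMod3 n fixes both ends.
        step₁ : ∀ {n} → 1 + n < 3 * m → Adj H (vertexAt n) (vertexAt (1 + n))
        step₁ {n} n< with divMod3 n | divMod3-correct n
        ... | q , 𝟎 | _  = corner-adjacent (at q) (λ ())
        ... | q , 𝟏 | _  = corner-adjacent (at q) (λ ())
        ... | q , 𝟐 | eq = Precedes.edge₂₀ (at-step (successor-exists (≤-reflexive (cong suc eq)) n<))

        step₂ : ∀ {n} → 2 + n < 3 * m → Adj H (vertexAt n) (vertexAt (2 + n))
        step₂ {n} n< with divMod3 n | divMod3-correct n
        ... | q , 𝟎 | _  = corner-adjacent (at q) (λ ())
        ... | q , 𝟏 | eq = Precedes.edge₁₀ (at-step (successor-exists (≤-reflexive (cong (2 +_) eq)) n<))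
        ... | q , 𝟐 | eq = Precedes.edge₂₁ (at-step (successor-exists (n≤1+n _) (subst (λ n → 2 + n < 3 * m) (sym eq) n<)))

      private
        cornerPosition : Fin 3 → ∀ {q} → q ≤ k → Fin (3 * m)
        cornerPosition r q≤k = fromℕ< (position-bounded r q≤k)

        vertexAt-cornerPosition : ∀ r {q} (q≤k : q ≤ k) → vertexAt (toℕ (cornerPosition r q≤k)) ≡ corner (at q) r
        vertexAt-cornerPosition r {q} q≤k = trans (cong vertexAt (toℕ-fromℕ< (position-bounded r q≤k))) (vertexAt-corner q r)

        final-corner : ∀ r → vertexAt (toℕ r + 3 * k) ≡ corner b r
        final-corner r = trans (vertexAt-corner k r) (cong (λ τ → corner τ r) at-last)

      startsWith : StartsWith (3 * m) (vertexAt ∘ toℕ) (t a)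
      startsWith r = cornerPosition i z≤n ,
        subst (_< 3) (sym (trans (toℕ-fromℕ< (position-bounded i z≤n)) (+-identityʳ (toℕ i)))) (toℕ<n i) ,
        trans (vertexAt-cornerPosition i z≤n) (trans (cong (λ τ → corner τ i) at-first) (corner-part a r))
        where i = part (t a r)

      endsWith : EndsWith (3 * m) (vertexAt ∘ toℕ) (t b)
      endsWith r = cornerPosition i ≤-refl ,
        subst (λ n → 3 * m ≤ n + 3) (sym (toℕ-fromℕ< (position-bounded i ≤-refl))) last-three ,
        trans (vertexAt-cornerPosition i ≤-refl) (trans (cong (λ τ → corner τ i) at-last) (corner-part b r))
        where
        i = part (t b r)
        last-three : 3 * m ≤ toℕ i + 3 * k + 3
        last-three = subst₂ _≤_ (sym (*-suc 3 k)) (+-comm 3 _) (+-monoʳ-≤ 3 (m≤n+m (3 * k) (toℕ i)))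

      squareCycle : Precedes b a → IsSquareHamCycle H (3 * m) (vertexAt ∘ toℕ)
      squareCycle b→a = squareHamCycle H squareSequence
        (λ eq → subst₂ (Adj H) (sym (final eq)) (sym first₀) (Precedes.edge₂₀ b→a) ,
                subst₂ (Adj H) (sym (final eq)) (sym first₁) (Precedes.edge₂₁ b→a))
        (λ eq → subst₂ (Adj H) (sym (penultimate eq)) (sym first₀) (Precedes.edge₁₀ b→a))
        where
        first₀ : vertexAt 0 ≡ corner a 𝟎
        first₀ = cong (λ τ → corner τ 𝟎) at-first
        first₁ : vertexAt 1 ≡ corner a 𝟏
        first₁ = cong (λ τ → corner τ 𝟏) at-first
        final : ∀ {n} → 1 + n ≡ 3 * m → vertexAt n ≡ corner b 𝟐
        final eq = trans (cong vertexAt (suc-injective (trans eq (*-suc 3 k)))) (final-corner 𝟐)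
        penultimate : ∀ {n} → 2 + n ≡ 3 * m → vertexAt n ≡ corner b 𝟏
        penultimate eq = trans (cong vertexAt (suc-injective (suc-injective (trans eq (*-suc 3 k))))) (final-corner 𝟏)

    module _ (min-degree : ∀ i j → i ≢ j → ∀ x → 99 * m ≤ 100 * deg H (i , x) j) (large : 100 ≤ m) where

      private
        D B : ℕ
        D = m / 100
        B = D + (D + D)

        nonNeighbourTriangles-few : ∀ {i} y j → i ≢ j → length (nonNeighbourTriangles (i , y) j) ≤ D
        nonNeighbourTriangles-few {i} y j i≢j =
          ≤-trans (≤-reflexive (length-map _ (nonNeighbours H (i , y) j))) (nonNeighbours-few H (min-degree i j i≢j y))

        length-++₃ : ∀ (xs ys zs : List (Fin m)) → length xs ≤ D → length ys ≤ D → length zs ≤ D →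
                     length (xs ++ ys ++ zs) ≤ B
        length-++₃ xs ys zs xs≤ ys≤ zs≤ = ≤-trans (≤-reflexive (trans (length-++ xs) (cong (length xs +_) (length-++ ys))))
                                                  (+-mono-≤ xs≤ (+-mono-≤ ys≤ zs≤))

        nonSuccessors-few : ∀ u → length (nonSuccessors u) ≤ B
        nonSuccessors-few u = length-++₃
          (nonNeighbourTriangles (corner u 𝟐) 𝟎) (nonNeighbourTriangles (corner u 𝟏) 𝟎)
          (nonNeighbourTriangles (corner u 𝟐) 𝟏)
          (nonNeighbourTriangles-few _ 𝟎 (λ ())) (nonNeighbourTriangles-few _ 𝟎 (λ ())) (nonNeighbourTriangles-few _ 𝟏 (λ ()))

        nonPredecessors-few : ∀ v → length (nonPredecessors v) ≤ B
        nonPredecessors-few v = length-++₃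
          (nonNeighbourTriangles (corner v 𝟎) 𝟐) (nonNeighbourTriangles (corner v 𝟎) 𝟏)
          (nonNeighbourTriangles (corner v 𝟏) 𝟐)
          (nonNeighbourTriangles-few _ 𝟐 (λ ())) (nonNeighbourTriangles-few _ 𝟏 (λ ())) (nonNeighbourTriangles-few _ 𝟐 (λ ()))

        B-small : 4 * B + 2 < m
        B-small = *-cancelˡ-≤ 2 (begin
          2 * suc (4 * B + 2) ≡⟨ solve 1 (λ D → con 2 :* (con 1 :+ (con 4 :* (D :+ (D :+ D)) :+ con 2)) := D :* con 24 :+ con 6) refl D ⟩
          D * 24 + 6          ≤⟨ +-mono-≤ (*-monoʳ-≤ D (m≤m+n 24 76)) (≤-trans (m≤m+n 6 94) large) ⟩
          D * 100 + m         ≤⟨ +-monoˡ-≤ m (m/n*n≤m m 100) ⟩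
          m + m               ≡⟨ solve 1 (λ m → m :+ m := con 2 :* m) refl m ⟩
          2 * m               ∎)
          where open ≤-Reasoning

        hamiltonianPath : ∀ {a b} → a ≢ b → HamiltonianPath Precedes a b
        hamiltonianPath = DenseDigraph.hamiltonianPath Precedes B nonSuccessors nonPredecessors
          nonSuccessors-few nonPredecessors-few ∉nonSuccessors⇒Precedes ∉nonPredecessors⇒Precedes B-small

        non-predecessor : ∃ λ b → b ∉ Fin.zero ∷ nonPredecessors Fin.zero
        non-predecessor = short⇒∃∉ _ (≤-trans (s≤s (s≤s (≤-trans (nonPredecessors-few Fin.zero) (m≤m+n B (3 * B)))))
                                      (≤-trans (≤-reflexive (+-comm 2 (4 * B))) (≤-trans (n≤1+n _) B-small)))

      squareHamiltonianCycle : ∃[ f ] IsSquareHamCycle H (3 * m) f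
      squareHamiltonianCycle = cycle (proj₂ non-predecessor)
        where
        cycle : ∀ {b} → b ∉ Fin.zero ∷ nonPredecessors Fin.zero → ∃[ f ] IsSquareHamCycle H (3 * m) f
        cycle {b} b∉ = vertexAt P ∘ toℕ , squareCycle P (∉nonPredecessors⇒Precedes (b∉ ∘ there))
          where
          P : HamiltonianPath Precedes Fin.zero b
          P = hamiltonianPath (λ 0≡b → b∉ (here (sym 0≡b)))

      squareHamiltonianPath : ∃[ g ] (IsSquareHamPath H (3 * m) g × StartsWith (3 * m) g (t Fin.zero) ×
                                      EndsWith (3 * m) g (t (fromℕ k)))
      squareHamiltonianPath = vertexAt P ∘ toℕ , squareHamPath H (squareSequence P) , startsWith P , endsWith P
        where
        P = hamiltonianPath (zero≢fromℕ (≤-trans (s≤s z≤n) (s≤s⁻¹ large)))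
          where
          zero≢fromℕ : ∀ {k} → 1 ≤ k → Fin.zero ≢ fromℕ k
          zero≢fromℕ {suc k} _ ()

module DegreeCondition where
  open import Data.Integer as ℤ using (+_)
  import Data.Integer.Properties as ℤ
  open import Data.Nat as ℕ using (ℕ)
  import Data.Nat.Properties as ℕ
  open import Data.Nat.Coprimality using (1-coprimeTo) renaming (sym to coprime-sym)
  open import Data.Rational
  open import Data.Rational.Properties
  import Data.Rational.Unnormalised as ℚᵘ
  import Data.Rational.Unnormalised.Properties as ℚᵘ
  open import Relation.Binary.PropositionalEquality

  α₀ : ℚ
  α₀ = + 1 / 100

  0<α₀ : 0ℚ < α₀
  0<α₀ = *<* (ℤ.+<+ (ℕ.s≤s ℕ.z≤n))

  private
    whole : ℕ → ℚ
    whole n = mkℚ (+ n) 0 (coprime-sym (1-coprimeTo n))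

    integral : ∀ n → + n / 1 ≡ whole n
    integral n = normalize-coprime (coprime-sym (1-coprimeTo n))

  almost-all⇒99% : ∀ {α'} m d → α' ≤ α₀ → (1ℚ - α') * (+ m / 1) ≤ + d / 1 → 99 ℕ.* m ℕ.≤ 100 ℕ.* d
  almost-all⇒99% {α'} m d α'≤α₀ bound rewrite integral m | integral d = ℤ.drop‿+≤+ (subst₂ ℤ._≤_
      (trans (ℤ.*-identityʳ _) (sym (ℤ.pos-* 99 m)))
      (trans (sym (ℤ.pos-* d 100)) (cong +_ (ℕ.*-comm d 100)))
      (ℚᵘ.drop-*≤* (ℚᵘ.≤-respˡ-≃ (toℚᵘ-homo-* (1ℚ - α₀) (whole m)) (toℚᵘ-mono-≤ 99%≤))))
    where
    99%≤ : (1ℚ - α₀) * whole m ≤ whole d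
    99%≤ = ≤-trans (*-monoʳ-≤-nonNeg _ (+-monoʳ-≤ 1ℚ (neg-antimono-≤ α'≤α₀))) bound

open import Defs
open import Data.Nat using (ℕ; suc; _*_; _≤_)
open import Data.Fin using (Fin; zero; fromℕ)
open import Data.Integer using (+_)
open import Data.Rational using (ℚ; 0ℚ; 1ℚ; _-_; _/_; _<_)
open import Data.Product using (_×_; _,_; ∃; ∃-syntax)
open import Relation.Binary.PropositionalEquality using (_≢_)
import Data.Rational
open import Data.Nat.Properties using (*-cancelˡ-≤)
open SquarePaths using (module TriangleCover)
open DegreeCondition using (α₀; 0<α₀; almost-all⇒99%)

lemma2p2 : ∃[ α₀ ] (0ℚ < α₀ ×
             (∀ (α' : ℚ) → 0ℚ < α' → α' Data.Rational.≤ α₀ →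
               ∃[ n₀ ] (∀ (k : ℕ) → n₀ ≤ 3 * suc k →
                 (H : TriGraph (suc k)) → (t : Fin (suc k) → Fin 3 → Vtx (suc k)) →
                 IsTriangleCover H t →
                 (∀ (i j : Fin 3) → i ≢ j → ∀ (x : Fin (suc k)) →
                   (1ℚ - α') Data.Rational.* ((+ suc k) / 1) Data.Rational.≤ ((+ deg H (i , x) j) / 1)) →
                 (∃[ f ] IsSquareHamCycle H (3 * suc k) f) ×
                 (∃[ g ] (IsSquareHamPath H (3 * suc k) g ×
                          StartsWith (3 * suc k) g (t zero) ×
                          EndsWith (3 * suc k) g (t (fromℕ k)))))))
lemma2p2 = α₀ , 0<α₀ , λ α' _ α'≤α₀ → 300 , λ k 300≤n H t cover degree →
  TriangleCover.squareHamiltonianCycle {H = H} {t} cover (min-degree α'≤α₀ H degree) (*-cancelˡ-≤ 3 300≤n) ,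
  TriangleCover.squareHamiltonianPath {H = H} {t} cover (min-degree α'≤α₀ H degree) (*-cancelˡ-≤ 3 300≤n)
  where
  min-degree : ∀ {α' k} → α' Data.Rational.≤ α₀ → (H : TriGraph (suc k)) →
               (∀ (i j : Fin 3) → i ≢ j → ∀ (x : Fin (suc k)) →
                 (1ℚ - α') Data.Rational.* ((+ suc k) / 1) Data.Rational.≤ ((+ deg H (i , x) j) / 1)) →
               ∀ (i j : Fin 3) → i ≢ j → ∀ x → 99 * suc k ≤ 100 * deg H (i , x) j
  min-degree {α'} {k} α'≤α₀ H degree i j i≢j x =
    almost-all⇒99% {α'} (suc k) (deg H (i , x) j) α'≤α₀ (degree i j i≢j x)
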